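{- Let $S$ be a clustering instance and $T$ be its execution tree with respect to $\mathcal{P}$. If a sequence of merges $\mathcal{M}=[u_1,\dots,u_t]$ is attained by $\mathcal{A}_\rho$ for some $\rho\in\mathcal{P}$, then there exists a node $v\in T$ at depth $t$ with $v=(\mathcal{M},\mathcal{Q})$, where $\mathcal{Q}\subseteq\mathcal{P}$ is exactly the set of values of $\rho$ for which $\mathcal{A}_\rho$ may attain $\mathcal{M}$. Conversely, for every node $v=(\mathcal{M},\mathcal{Q})\in T$, $\mathcal{M}$ is a valid sequence of merges attainable by $\mathcal{A}_\rho$ for some $\rho\in\mathcal{P}$.
   Context: A clustering instance is a finite point set $S$, $|S|=n$. Let $\Delta=\{D_1,\dots,D_l\}$ be merge functions $D_i(A,B;d')$, $\delta=\{d_1,\dots,d_m\}$ metrics, $d=lm-1$, pairs indexed by $1,\dots,d+1$, $\alpha^{(\rho)}_k=\rho_k$ ($k\le d$), $\alpha^{(\rho)}_{d+1}=1-\sum_{k\le d}\rho_k$, and $D_\rho(A,B;\delta)=\sum_{i,j}\alpha^{(\rho)}_{i,j}D_i(A,B;d_j)$. $\mathcal{A}_\rho$ is the linkage algorithm which starts from singleton clusters and repeatedly merges a pair of current clusters minimizing $D_\rho$; a merge sequence is attainable (may be attained) by $\mathcal{A}_\rho$ if each merge is of a pair minimizing $D_\rho$ among the current cluster pairs. Let $\emptyset\neq\mathcal{P}\subseteq[0,1]^d$. The execution tree on $S$ with respect to $\mathcal{P}$ is the depth-$n$ rooted tree with root $([],\mathcal{P})$ in which the children of a node $([u_1,\dots,u_t],\mathcal{Q})$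 with $t<n-1$ are the nodes $([u_1,\dots,u_t,(A,B)],\mathcal{Q}_{A,B})$ for all cluster pairs $A,B\subseteq S$ such that $(A,B)$ is the $(t+1)$-st merge by $\mathcal{A}_\rho$ for exactly the $\rho\in\mathcal{Q}_{A,B}$, with $\emptyset\neq\mathcal{Q}_{A,B}\subseteq\mathcal{Q}$. -}

module Defs where

open import Level using (0ℓ)
open import Data.Nat using (ℕ; zero; suc; _∸_; _<?_)
  renaming (_<_ to _<ℕ_; _*_ to _*ℕ_)
open import Data.Fin using (Fin; toℕ; fromℕ<; combine)
open import Data.Fin.Subset using (Subset; ⁅_⁆; _∪_)
open import Data.Product using (Σ; ∃; _×_; _,_)
open import Data.Sum using (_⊎_)
open import Data.Unit using (⊤)
open import Data.List using (List; []; _∷_; _++_; [_]; length)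
open import Relation.Nullary using (¬_; yes; no)
open import Relation.Binary.PropositionalEquality using (_≡_)
open import Algebra.Structures using (IsCommutativeRing)
open import Relation.Binary.Structures using (IsTotalOrder)

-- The real numbers are not available in agda-stdlib.  We work over an
-- arbitrary ordered field (the reals being the intended instance).

record OrderedField : Set₁ where
  infixl 6 _+_ _-_
  infixl 7 _*_
  infix 4 _≤_
  field
    Carrier : Set
    _+_ _*_ : Carrier → Carrier → Carrier
    -_      : Carrier → Carrier
    0# 1#   : Carrier
    _≤_     : Carrier → Carrier → Set
    _⁻¹     : Carrier → Carrier
    isCommutativeRing : IsCommutativeRing _≡_ _+_ _*_ -_ 0# 1#
    isTotalOrder      : IsTotalOrder _≡_ _≤_
    ⁻¹-inverse        : ∀ x → ¬ (x ≡ 0#) → x * (x ⁻¹) ≡ 1#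
    0≢1               : ¬ (0# ≡ 1#)
    +-mono-≤          : ∀ {x y} z → x ≤ y → x + z ≤ y + z
    *-nonneg          : ∀ {x y} → 0# ≤ x → 0# ≤ y → 0# ≤ x * y

  _-_ : Carrier → Carrier → Carrier
  x - y = x + (- y)

module Clustering (F : OrderedField) where
  open OrderedField F

  sumF : ∀ {k} → (Fin k → Carrier) → Carrier
  sumF {zero}  f = 0#
  sumF {suc k} f = f Data.Fin.zero + sumF (λ i → f (Data.Fin.suc i))

  Metric : ℕ → Set
  Metric n = Fin n → Fin n → Carrier

  IsMetric : ∀ {n} → Metric n → Set
  IsMetric {n} d =
    (∀ x y → 0# ≤ d x y) ×
    (∀ x y → d x y ≡ 0# → x ≡ y) ×
    (∀ x → d x x ≡ 0#) ×
    (∀ x y → d x y ≡ d y x) ×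
    (∀ x y z → d x z ≤ d x y + d y z)

  MergeFn : ℕ → Set
  MergeFn n = Subset n → Subset n → Metric n → Carrier

  Param : ℕ → Set
  Param d = Fin d → Carrier

  InUnitCube : ∀ {d} → Param d → Set
  InUnitCube ρ = ∀ k → (0# ≤ ρ k) × (ρ k ≤ 1#)

  -- α^{(ρ)}_k for k ∈ {1..d+1} (0-indexed here), d = l·m − 1
  α : ∀ {L} → Param (L ∸ 1) → Fin L → Carrier
  α {L} ρ k with toℕ k <? (L ∸ 1)
  ... | yes p = ρ (fromℕ< p)
  ... | no _  = 1# - sumF ρ

  -- D_ρ(A,B;δ) = Σ_{i,j} α_{i,j} D_i(A,B;d_j); the pair (i,j) gets index combine i j
  Dρ : ∀ {n l m} → (Fin l → MergeFn n) → (Fin m → Metric n) →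
       Param (l *ℕ m ∸ 1) → Subset n → Subset n → Carrier
  Dρ {l = l} {m} Δ δ ρ A B =
    sumF {l} (λ i → sumF {m} (λ j → α ρ (combine i j) * Δ i A B (δ j)))

  Clusters : ℕ → Set₁
  Clusters n = Subset n → Set

  singletons : ∀ {n} → Clusters n
  singletons X = ∃ λ i → X ≡ ⁅ i ⁆

  merge : ∀ {n} → Clusters n → Subset n → Subset n → Clusters n
  merge C A B X = (C X × ¬ (X ≡ A) × ¬ (X ≡ B)) ⊎ (X ≡ A ∪ B)

  Merge : ℕ → Set
  Merge n = Subset n × Subset n

  after : ∀ {n} → Clusters n → List (Merge n) → Clusters n
  after C []            = C
  after C ((A , B) ∷ M) = after (merge C A B) M

  MinPair : ∀ {n} → (Subset n → Subset n → Carrier) → Clusters n →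
            Subset n → Subset n → Set
  MinPair D C A B = C A × C B × ¬ (A ≡ B) ×
    (∀ X Y → C X → C Y → ¬ (X ≡ Y) → D A B ≤ D X Y)

  AttainableFrom : ∀ {n} → (Subset n → Subset n → Carrier) → Clusters n →
                   List (Merge n) → Set
  AttainableFrom D C []            = ⊤
  AttainableFrom D C ((A , B) ∷ M) = MinPair D C A B × AttainableFrom D (merge C A B) M

  module Tree {n l m : ℕ} (Δ : Fin l → MergeFn n) (δ : Fin m → Metric n) where
    d : ℕ
    d = l *ℕ m ∸ 1

    Attainable : Param d → List (Merge n) → Set
    Attainable ρ M = AttainableFrom (Dρ Δ δ ρ) singletons M

    data IsNode (𝒫 : Param d → Set) : List (Merge n) → (Param d → Set) → Set₁ where
      root  : IsNode 𝒫 [] 𝒫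
      child : ∀ {M 𝒬} → IsNode 𝒫 M 𝒬 → length M <ℕ n ∸ 1 →
              (A B : Subset n) →
              (∃ λ ρ → 𝒬 ρ × MinPair (Dρ Δ δ ρ) (after singletons M) A B) →
              IsNode 𝒫 (M ++ [ (A , B) ])
                (λ ρ → 𝒬 ρ × MinPair (Dρ Δ δ ρ) (after singletons M) A B)

{-# OPTIONS --safe #-}
module Submission where

-- Attainability of M ∷ʳ (A , B) means attainability of M followed by (A , B)
-- being a minimising pair of the clustering reached after M; this is exactly
-- the condition under which the execution tree grows the child labelled
-- (A , B), so node parameter sets and attaining parameter sets are built by
-- the same recursion.  The only other ingredient is the depth bound of the
-- tree: a merge of two distinct clusters lowers the number of clusters, so at
-- most n ∸ 1 merges can be attained from the n singletons.

open import Defs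
open import Data.Nat using (ℕ; suc; _∸_; _≤_; _<_; s≤s; z≤n)
open import Data.Nat.Properties using (≤-trans; ≤-pred; ≤-reflexive)
open import Data.Fin using (Fin)
open import Data.Fin.Subset using (Subset; ⁅_⁆; _∪_)
open import Data.Product using (Σ; ∃; _×_; _,_; proj₁)
open import Data.Sum using (inj₁; inj₂)
open import Data.Unit using (tt)
open import Data.List using (List; []; _∷_; [_]; _∷ʳ_; length; filter; tabulate)
open import Data.List.Properties using (filter-notAll; length-tabulate; length-++-comm)
open import Data.List.Membership.Propositional using (_∈_)
open import Data.List.Membership.Propositional.Properties using (∈-filter⁺; ∈-tabulate⁺)
open import Data.List.Relation.Unary.Any using (here; there)
import Data.List.Relation.Unary.Any as Any
open import Data.List.Reverse using (Reverse; reverseView; []; _∶_∶ʳ_)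
open import Data.Bool.Properties using () renaming (_≟_ to _≟ᵇ_)
open import Data.Vec.Properties using (≡-dec)
open import Relation.Nullary using (¬?)
open import Relation.Nullary.Negation using (contradiction)
open import Relation.Binary.Definitions using (DecidableEquality)
open import Relation.Binary.PropositionalEquality using (_≢_; refl; sym; subst)
open import Function.Bundles using (_⇔_; mk⇔)

module _ {a} {A : Set a} (_≟_ : DecidableEquality A) where

  remove : A → List A → List A
  remove x = filter (λ y → ¬? (y ≟ x))

  ∈-remove⁺ : ∀ {x y xs} → y ∈ xs → y ≢ x → y ∈ remove x xs
  ∈-remove⁺ = ∈-filter⁺ _

  length-remove< : ∀ {x xs} → x ∈ xs → length (remove x xs) < length xs
  length-remove< {xs = xs} x∈xs =
    filter-notAll _ xs (Any.map (λ x≡y y≢x → y≢x (sym x≡y)) x∈xs)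

2≤length : ∀ {a} {A : Set a} {x y : A} (xs : List A) → x ∈ xs → y ∈ xs → x ≢ y → 2 ≤ length xs
2≤length (_ ∷ [])    (here refl) (here refl) x≢y = contradiction refl x≢y
2≤length (_ ∷ [])    _           (there ())  _
2≤length (_ ∷ [])    (there ())  _           _
2≤length (_ ∷ _ ∷ _) _           _           _   = s≤s (s≤s z≤n)

module _ (F : OrderedField) where
  open OrderedField F using (Carrier)
  open Clustering F

  attainableFrom-∷ʳ⁺ : ∀ {n} {D : Subset n → Subset n → Carrier} {C A B} M →
    AttainableFrom D C M → MinPair D (after C M) A B → AttainableFrom D C (M ∷ʳ (A , B))
  attainableFrom-∷ʳ⁺ []      _         mp = mp , tt
  attainableFrom-∷ʳ⁺ (_ ∷ M) (mp₀ , at) mp = mp₀ , attainableFrom-∷ʳ⁺ M at mp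

  attainableFrom-∷ʳ⁻ : ∀ {n} {D : Subset n → Subset n → Carrier} {C A B} M →
    AttainableFrom D C (M ∷ʳ (A , B)) → AttainableFrom D C M × MinPair D (after C M) A B
  attainableFrom-∷ʳ⁻ []      (mp , _)   = tt , mp
  attainableFrom-∷ʳ⁻ (_ ∷ M) (mp₀ , at) =
    let (atM , mp) = attainableFrom-∷ʳ⁻ M at in (mp₀ , atM) , mp

  AtMost : ∀ {n} → ℕ → Clusters n → Set
  AtMost {n} k C = ∃ λ (L : List (Subset n)) → (∀ X → C X → X ∈ L) × length L ≤ k

  singletons-atMost : ∀ {n} → AtMost n (singletons {n})
  singletons-atMost {n} =
    tabulate ⁅_⁆ , (λ { X (i , refl) → ∈-tabulate⁺ i }) , ≤-reflexive (length-tabulate ⁅_⁆)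

  atMost-distinct⇒2≤ : ∀ {n k} {C : Clusters n} {A B} →
    AtMost k C → C A → C B → A ≢ B → 2 ≤ k
  atMost-distinct⇒2≤ (L , cover , len) cA cB A≢B =
    ≤-trans (2≤length L (cover _ cA) (cover _ cB) A≢B) len

  merge-atMost : ∀ {n k} {C : Clusters n} {A B} →
    AtMost (suc k) C → C A → C B → A ≢ B → AtMost k (merge C A B)
  merge-atMost {k = k} {C} {A} {B} (L , cover , len) cA cB A≢B = (A ∪ B) ∷ L₂ , cover′ , len′
    where
    _≟ˢ_ = ≡-dec _≟ᵇ_
    L₁ = remove _≟ˢ_ A L
    L₂ = remove _≟ˢ_ B L₁

    cover′ : ∀ X → merge C A B X → X ∈ (A ∪ B) ∷ L₂
    cover′ X (inj₂ X≡A∪B)            = here X≡A∪B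
    cover′ X (inj₁ (cX , X≢A , X≢B)) = there (∈-remove⁺ _≟ˢ_ (∈-remove⁺ _≟ˢ_ (cover X cX) X≢A) X≢B)

    B∈L₁ : B ∈ L₁
    B∈L₁ = ∈-remove⁺ _≟ˢ_ (cover B cB) (λ B≡A → A≢B (sym B≡A))

    len′ : suc (length L₂) ≤ k
    len′ = ≤-pred (≤-trans (s≤s (length-remove< _≟ˢ_ B∈L₁))
                           (≤-trans (length-remove< _≟ˢ_ (cover A cA)) len))

  attainableFrom-length≤ : ∀ {n k} {D : Subset n → Subset n → Carrier} {C} M →
    AttainableFrom D C M → AtMost k C → length M ≤ k ∸ 1
  attainableFrom-length≤ []            _                           _     = z≤n
  attainableFrom-length≤ ((A , B) ∷ M) ((cA , cB , A≢B , _) , at) bound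
    with atMost-distinct⇒2≤ bound cA cB A≢B
  ... | s≤s (s≤s _) = s≤s (attainableFrom-length≤ M at (merge-atMost bound cA cB A≢B))

  module _ {n l m : ℕ} (Δ : Fin l → MergeFn n) (δ : Fin m → Metric n) where
    open Tree Δ δ

    node⇒attainable : ∀ {𝒫 M 𝒬} → IsNode 𝒫 M 𝒬 → ∀ ρ → 𝒬 ρ → 𝒫 ρ × Attainable ρ M
    node⇒attainable root                    ρ 𝒫ρ        = 𝒫ρ , tt
    node⇒attainable (child {M} node _ _ _ _) ρ (𝒬ρ , mp) =
      let (𝒫ρ , at) = node⇒attainable node ρ 𝒬ρ in 𝒫ρ , attainableFrom-∷ʳ⁺ M at mp

    node-nonempty : ∀ {𝒫 M 𝒬} → ∃ 𝒫 → IsNode 𝒫 M 𝒬 → ∃ 𝒬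
    node-nonempty 𝒫≢∅ root                   = 𝒫≢∅
    node-nonempty _   (child _ _ _ _ witness) = witness

    attainable⇒node : ∀ {𝒫} {M : List (Merge n)} → Reverse M → (∃ λ ρ → 𝒫 ρ × Attainable ρ M) →
      Σ (Param d → Set) λ 𝒬 → IsNode 𝒫 M 𝒬 × (∀ ρ → 𝒫 ρ × Attainable ρ M → 𝒬 ρ)
    attainable⇒node {𝒫} [] _ = 𝒫 , root , λ _ → proj₁
    attainable⇒node (M ∶ rev ∶ʳ (A , B)) (ρ , 𝒫ρ , at) =
      let (atM , mp)       = attainableFrom-∷ʳ⁻ M at
          (𝒬 , node , ⊇𝒬) = attainable⇒node rev (ρ , 𝒫ρ , atM)
          depth<           = subst (_≤ n ∸ 1) (length-++-comm M [ (A , B) ])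
                               (attainableFrom-length≤ (M ∷ʳ (A , B)) at singletons-atMost)
      in _ , child node depth< A B (ρ , ⊇𝒬 ρ (𝒫ρ , atM) , mp) ,
         λ σ (𝒫σ , atσ) → let (atσM , mpσ) = attainableFrom-∷ʳ⁻ M atσ
                           in ⊇𝒬 σ (𝒫σ , atσM) , mpσ

lemma5 : (F : OrderedField) →
    let open Clustering F in
    {n l m : ℕ} (Δ : Fin l → MergeFn n) (δ : Fin m → Metric n) →
    (∀ j → IsMetric (δ j)) →
    let open Tree Δ δ in
    (𝒫 : Param d → Set) → (∃ λ ρ → 𝒫 ρ) → (∀ ρ → 𝒫 ρ → InUnitCube ρ) →
    ((M : List (Merge n)) → (∃ λ ρ → 𝒫 ρ × Attainable ρ M) →
    Σ (Param d → Set) λ 𝒬 → IsNode 𝒫 M 𝒬 ×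
    (∀ ρ → 𝒬 ρ ⇔ (𝒫 ρ × Attainable ρ M)))
    ×
    ((M : List (Merge n)) (𝒬 : Param d → Set) → IsNode 𝒫 M 𝒬 →
    ∃ λ ρ → 𝒫 ρ × Attainable ρ M)
lemma5 F {n} Δ δ _ 𝒫 𝒫≢∅ _ = node-of-attainable , attainable-of-node
  where
  open Clustering F
  open Tree Δ δ

  node-of-attainable : (M : List (Merge n)) → (∃ λ ρ → 𝒫 ρ × Attainable ρ M) →
    Σ (Param d → Set) λ 𝒬 → IsNode 𝒫 M 𝒬 × (∀ ρ → 𝒬 ρ ⇔ (𝒫 ρ × Attainable ρ M))
  node-of-attainable M attained =
    let (𝒬 , node , ⊇𝒬) = attainable⇒node F Δ δ (reverseView M) attained
    in 𝒬 , node , λ ρ → mk⇔ (node⇒attainable F Δ δ node ρ) (⊇𝒬 ρ)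

  attainable-of-node : (M : List (Merge n)) (𝒬 : Param d → Set) → IsNode 𝒫 M 𝒬 →
    ∃ λ ρ → 𝒫 ρ × Attainable ρ M
  attainable-of-node M 𝒬 node =
    let (ρ , 𝒬ρ) = node-nonempty F Δ δ 𝒫≢∅ node in ρ , node⇒attainable F Δ δ node ρ 𝒬ρ
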